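{- Let $p$ be an odd prime, $N\ge1$ an integer, and $\mathcal V=\mathcal V(p,N)$. Then for every $\alpha\in\mathbb{Z}[\omega]$, \[ A_{p,N}(\alpha,\mathcal V):=\frac1{\#\mathcal V}\sum_{x\in\mathcal V}\mathfrak d_{p,N}(\alpha,x)^2=\mathfrak d_{p,N}(0,\alpha)^2+\frac14-\frac1{4p}-\frac1{4p^2}. \]
   Context: $\omega=\exp(2\pi i/p)$; $\mathbb{Z}[\omega]=\{\sum_{j=1}^{p-1}a_j\omega^j:a_j\in\mathbb{Z}\}$; $\mathcal V(p,N)=\{\sum_{j=1}^{p-1}a_j\omega^j: a_j\in\{ -N,N\}\}$. For $\gamma\in\mathbb{Q}(\omega)$, $\mathrm{Tr}(\gamma)=\sum_{\sigma\in\mathrm{Gal}(\mathbb{Q}(\omega)/\mathbb{Q})}\sigma(\gamma)$, $\|\gamma\|=\big(\sum_{j=1}^{p-1}\mathrm{Tr}(\gamma\omega^j)^2\big)^{1/2}$, and $\mathfrak d_{p,N}(\alpha,\beta)=\|\beta-\alpha\|/(2Np(p-1)^{1/2})$. -}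

module Defs where

open import Data.Nat as ℕ using (ℕ; zero; suc; _%_; _≡ᵇ_)
open import Data.Integer as ℤ using (ℤ; +_)
open import Data.Rational as ℚ using (ℚ; _/_)
open import Data.Fin using (Fin; toℕ)
open import Data.Vec using (Vec; []; _∷_; lookup)
open import Data.List using (List; []; _∷_; map; concatMap; applyUpTo; allFin; _++_; foldr)
open import Data.Product using (_×_; _,_)
open import Data.Bool using (Bool; true; false; if_then_else_)

sumℤ : List ℤ → ℤ
sumℤ = foldr ℤ._+_ (+ 0)

-- An element of ℤ[ω] = { Σ_{j=1}^{p-1} a_j ω^j } is given by its coefficient
-- vector a : Fin (p-1) → ℤ ; index j : Fin (p-1) stands for the exponent toℕ j + 1.
Zω : ℕ → Set
Zω p = Fin (p ℕ.∸ 1) → ℤ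

-- Formal cyclotomic expressions Σ c ω^e (list of (coefficient, exponent)),
-- exponents read modulo p since ω^p = 1.
Expr : Set
Expr = List (ℤ × ℕ)

toExpr : (p : ℕ) → Zω p → Expr
toExpr p a = map (λ j → (a j , suc (toℕ j))) (allFin (p ℕ.∸ 1))

mulPow : ℕ → Expr → Expr
mulPow j = map (λ { (c , e) → (c , e ℕ.+ j) })

σ : ℕ → Expr → Expr
σ k = map (λ { (c , e) → (c , e ℕ.* k) })

-- Tr(γ) = Σ_{σ ∈ Gal(ℚ(ω)/ℚ)} σ(γ) = Σ_{k=1}^{p-1} σ_k(γ), as a formal expression
TrExpr : ℕ → Expr → Expr
TrExpr p γ = concatMap (λ k → σ (suc k) γ) (applyUpTo (λ i → i) (p ℕ.∸ 1))

coef : ℕ → ℕ → Expr → ℤ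
coef zero    r γ = + 0
coef (suc q) r γ = sumℤ (map (λ { (c , e) → if (e % suc q) ≡ᵇ r then c else + 0 }) γ)

-- Value of an expression known to be rational (Galois-invariant), e.g. a trace:
-- if γ = c₀ + c Σ_{e=1}^{p-1} ω^e then, since 1 + ω + … + ω^{p-1} = 0, γ = c₀ - c.
ratValue : ℕ → Expr → ℤ
ratValue p γ = coef p 0 γ ℤ.- coef p 1 γ

Tr : (p : ℕ) → Zω p → ℤ
Tr p γ = ratValue p (TrExpr p (toExpr p γ))

Trω : (p : ℕ) → Zω p → ℕ → ℤ
Trω p γ j = ratValue p (TrExpr p (mulPow j (toExpr p γ)))

normSq : (p : ℕ) → Zω p → ℤ
normSq p γ = sumℤ (applyUpTo (λ i → Trω p γ (suc i) ℤ.* Trω p γ (suc i)) (p ℕ.∸ 1))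

subω : (p : ℕ) → Zω p → Zω p → Zω p
subω p β α j = β j ℤ.- α j

0ω : (p : ℕ) → Zω p
0ω p j = + 0

-- ℕ → ℚ reciprocal (only used at nonzero arguments)
invℕ : ℕ → ℚ
invℕ zero    = ℚ.0ℚ
invℕ (suc n) = + 1 / suc n

fromℤ : ℤ → ℚ
fromℤ z = z / 1

-- 𝔡_{p,N}(α,β)² = ‖β-α‖² / (2 N p (p-1)^{1/2})² = ‖β-α‖² / (4 N² p² (p-1))
dSq : (p N : ℕ) → Zω p → Zω p → ℚ
dSq p N α β = fromℤ (normSq p (subω p β α)) ℚ.* invℕ (4 ℕ.* (N ℕ.* N) ℕ.* (p ℕ.* p) ℕ.* (p ℕ.∸ 1))

allSigns : (n : ℕ) → List (Vec Bool n)
allSigns zero    = [] ∷ []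
allSigns (suc n) = map (true ∷_) (allSigns n) ++ map (false ∷_) (allSigns n)

signed : (p N : ℕ) → Vec Bool (p ℕ.∸ 1) → Zω p
signed p N s j = if lookup s j then + N else ℤ.- (+ N)

-- 𝒱(p,N) as a list (its 2^{p-1} elements are pairwise distinct, since
-- ω, …, ω^{p-1} is a ℤ-basis of ℤ[ω])
𝒱 : (p N : ℕ) → List (Zω p)
𝒱 p N = map (signed p N) (allSigns (p ℕ.∸ 1))

sumℚ : List ℚ → ℚ
sumℚ = foldr ℚ._+_ ℚ.0ℚ

A : (p N : ℕ) → Zω p → ℚ
A p N α = invℕ (2 ℕ.^ (p ℕ.∸ 1)) ℚ.* sumℚ (map (dSq p N α) (𝒱 p N))

{-# OPTIONS --safe #-}
module Submission where

-- Write ℓ_k(γ) = Tr(γ ω^(k+1)), so that ‖γ‖² = Σ_k ℓ_k(γ)², where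
-- ℓ_k(γ) = Σ_i γ_i Tr(ω^(i+1) ω^(k+1)) is linear in the coordinates of γ. Averaging
-- (ℓ_k(x) - ℓ_k(α))² over the 2^(p-1) sign vectors x ∈ 𝒱 kills all cross terms and leaves
-- ℓ_k(α)² + N² Σ_i Tr(ω^(i+k+2))². Since Tr(ω^e) is p - 1 when p ∣ e and -1 otherwise, and exactly
-- one i per row has p ∣ i + k + 2, each row sum is (p-1)² + (p-2). Summing over k and dividing by
-- 4N²p²(p-1) gives 𝔡(0,α)² + 1/4 - 1/(4p) - 1/(4p²).

open import Defs

open import Data.Bool using (Bool; true; false; if_then_else_)
open import Data.Fin as Fin using (Fin; toℕ)
import Data.Fin.Properties as Finₚ
open import Data.Integer as ℤ using (ℤ; +_; 0ℤ; 1ℤ; -1ℤ; _+_; _*_; _-_; -_)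
import Data.Integer.Properties as ℤₚ
open import Data.Integer.Solver using (module +-*-Solver)
open import Data.List using (_∷_; []; _++_; map; applyUpTo; tabulate; allFin; concatMap)
import Data.List.Properties as Listₚ
open import Data.Nat as ℕ using (ℕ; zero; suc; NonZero; s≤s; _%_; _/_; _∸_; _^_; _≡ᵇ_; _<_; _≤_)
import Data.Nat.Properties as ℕₚ
open import Data.Nat.Coprimality as Coprimality using (Coprime; coprime-Bézout; 1-coprimeTo)
open import Data.Nat.DivMod using (m≡m%n+[m/n]*n; m<n⇒m%n≡m; [m+kn]%n≡m%n; %-distribˡ-*; m%n%n≡m%n; m%n<n)
open import Data.Nat.Divisibility using (_∣_; _∣?_; divides; ∣-refl; ∣m⇒∣m*n; n∣m⇒m%n≡0; m%n≡0⇒n∣m)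
open import Data.Nat.GCD using (module Bézout)
open import Data.Nat.Primality using (Prime; euclidsLemma; prime⇒irreducible; prime⇒nonTrivial)
import Data.Nat.Solver as ℕSolver
open import Data.Product using (∃; _,_; _×_)
open import Data.Rational as ℚ using (ℚ; 1ℚ; mkℚ)
import Data.Rational.Properties as ℚₚ
import Data.Rational.Solver as ℚSolver
open import Data.Sum using (inj₁; inj₂)
open import Data.Vec using (Vec; _∷_; lookup)
open import Data.Vec.Functional using (removeAt)
open import Function using (_∘_; id)
open import Relation.Binary.PropositionalEquality
open import Relation.Nullary using (¬_; contradiction; yes; no)
open import Relation.Nullary.Decidable using (dec-true; dec-false)

open import Algebra.Properties.Semiring.Sum ℤₚ.+-*-semiring
  using (sum; sum-syntax; sum-cong-≗; ∑-distrib-+; sum-replicate-zero; sum-remove; *-distribˡ-sum)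

-- Finite sums over ℤ

infix 8 _²
_² : ℤ → ℤ
x ² = x * x

∑-const : ∀ n c → ∑[ i < n ] c ≡ + n * c
∑-const zero    c = sym (ℤₚ.*-zeroˡ c)
∑-const (suc n) c = trans (cong (_+_ c) (∑-const n c)) (sym (ℤₚ.suc-* (+ n) c))

∑-neg : ∀ {n} (f : Fin n → ℤ) → ∑[ i < n ] (- f i) ≡ - ∑[ i < n ] f i
∑-neg {zero}  f = refl
∑-neg {suc n} f =
  trans (cong (_+_ (- f Fin.zero)) (∑-neg (f ∘ Fin.suc))) (sym (ℤₚ.neg-distrib-+ (f Fin.zero) _))

∑-distrib-- : ∀ {n} (f g : Fin n → ℤ) → ∑[ i < n ] (f i - g i) ≡ ∑[ i < n ] f i - ∑[ i < n ] g i
∑-distrib-- f g = trans (∑-distrib-+ f (λ i → - g i)) (cong (_+_ (sum f)) (∑-neg g))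

∑-const-except : ∀ {n} (f : Fin n → ℤ) i b → (∀ j → j ≢ i → f j ≡ b) →
                 ∑[ j < n ] f j ≡ f i - b + + n * b
∑-const-except {suc n} f i b f≡b = begin
  sum f                    ≡⟨ sum-remove {i = i} f ⟩
  f i + sum (removeAt f i) ≡⟨ cong (_+_ (f i)) (sum-cong-≗ (λ j → f≡b _ (Finₚ.punchInᵢ≢i i j))) ⟩
  f i + ∑[ j < n ] b       ≡⟨ cong (_+_ (f i)) (∑-const n b) ⟩
  f i + + n * b            ≡⟨ solve 3 (λ x b n → x :+ n :* b := x :- b :+ (con 1ℤ :+ n) :* b) refl (f i) b (+ n) ⟩
  f i - b + + suc n * b    ∎
  where open ≡-Reasoning
        open +-*-Solver

sumℤ-tabulate : ∀ {n} (f : Fin n → ℤ) → sumℤ (tabulate f) ≡ ∑[ i < n ] f i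
sumℤ-tabulate {zero}  f = refl
sumℤ-tabulate {suc n} f = cong (_+_ (f Fin.zero)) (sumℤ-tabulate (f ∘ Fin.suc))

sumℤ-applyUpTo : ∀ n (f : ℕ → ℤ) → sumℤ (applyUpTo f n) ≡ ∑[ i < n ] f (toℕ i)
sumℤ-applyUpTo zero    f = refl
sumℤ-applyUpTo (suc n) f = cong (_+_ (f 0)) (sumℤ-applyUpTo n (f ∘ suc))

module _ {A : Set} where

  sumℤ-map-++ : ∀ (g : A → ℤ) xs ys → sumℤ (map g (xs ++ ys)) ≡ sumℤ (map g xs) + sumℤ (map g ys)
  sumℤ-map-++ g []       ys = sym (ℤₚ.+-identityˡ _)
  sumℤ-map-++ g (x ∷ xs) ys =
    trans (cong (_+_ (g x)) (sumℤ-map-++ g xs ys)) (sym (ℤₚ.+-assoc (g x) _ _))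

  sumℤ-map-∑ : ∀ {n} (f : A → Fin n → ℤ) xs →
               sumℤ (map (λ x → ∑[ k < n ] f x k) xs) ≡ ∑[ k < n ] sumℤ (map (λ x → f x k) xs)
  sumℤ-map-∑ {n} f []       = sym (sum-replicate-zero n)
  sumℤ-map-∑ {n} f (x ∷ xs) =
    trans (cong (_+_ (∑[ k < n ] f x k)) (sumℤ-map-∑ f xs)) (sym (∑-distrib-+ (f x) _))

-- Arithmetic modulo n

if-≡ᵇ-yes : ∀ {A : Set} {m n} {x y : A} → m ≡ n → (if m ≡ᵇ n then x else y) ≡ x
if-≡ᵇ-yes {m = m} {n} {x} {y} m≡n = cong (if_then x else y) (dec-true (m ℕ.≟ n) m≡n)

if-≡ᵇ-no : ∀ {A : Set} {m n} {x y : A} → m ≢ n → (if m ≡ᵇ n then x else y) ≡ y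
if-≡ᵇ-no {m = m} {n} {x} {y} m≢n = cong (if_then x else y) (dec-false (m ℕ.≟ n) m≢n)

%-≡⇒∣∸ : ∀ {n} .{{_ : NonZero n}} a b → a % n ≡ b % n → n ∣ b ∸ a
%-≡⇒∣∸ {n} a b eq = divides (b / n ∸ a / n) (begin
  b ∸ a
    ≡⟨ cong₂ _∸_ (m≡m%n+[m/n]*n b n) (m≡m%n+[m/n]*n a n) ⟩
  (b % n ℕ.+ b / n ℕ.* n) ∸ (a % n ℕ.+ a / n ℕ.* n)
    ≡⟨ cong (λ r → (b % n ℕ.+ b / n ℕ.* n) ∸ (r ℕ.+ a / n ℕ.* n)) eq ⟩
  (b % n ℕ.+ b / n ℕ.* n) ∸ (b % n ℕ.+ a / n ℕ.* n)
    ≡⟨ ℕₚ.[m+n]∸[m+o]≡n∸o (b % n) _ _ ⟩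
  b / n ℕ.* n ∸ a / n ℕ.* n
    ≡⟨ ℕₚ.*-distribʳ-∸ n (b / n) (a / n) ⟨
  (b / n ∸ a / n) ℕ.* n ∎)
  where open ≡-Reasoning

∣∧<⇒≡0 : ∀ {n d} .{{_ : NonZero n}} → d < n → n ∣ d → d ≡ 0
∣∧<⇒≡0 {n} {d} d<n n∣d = trans (sym (m<n⇒m%n≡m d<n)) (n∣m⇒m%n≡0 d n n∣d)

∣∧<2*⇒≡ : ∀ {n s} → 0 < s → s < n ℕ.+ n → n ∣ s → s ≡ n
∣∧<2*⇒≡     0<s _    (divides zero          refl) = contradiction 0<s (λ ())
∣∧<2*⇒≡ {n} _   _    (divides 1             refl) = ℕₚ.+-identityʳ n
∣∧<2*⇒≡ {n} _   s<2n (divides (suc (suc d)) refl) =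
  contradiction s<2n (ℕₚ.≤⇒≯ (ℕₚ.+-monoʳ-≤ n (ℕₚ.m≤m+n n (d ℕ.* n))))

[m*[n%o]]%o≡[m*n]%o : ∀ m n o .{{_ : NonZero o}} → (m ℕ.* (n % o)) % o ≡ (m ℕ.* n) % o
[m*[n%o]]%o≡[m*n]%o m n o = begin
  (m ℕ.* (n % o)) % o           ≡⟨ %-distribˡ-* m (n % o) o ⟩
  ((m % o) ℕ.* (n % o % o)) % o ≡⟨ cong (λ r → ((m % o) ℕ.* r) % o) (m%n%n≡m%n n o) ⟩
  ((m % o) ℕ.* (n % o)) % o     ≡⟨ %-distribˡ-* m n o ⟨
  (m ℕ.* n) % o                 ∎
  where open ≡-Reasoning

-- From ℤ to ℚ

fromℤ≡mkℚ : ∀ z → fromℤ z ≡ mkℚ z 0 (Coprimality.sym (1-coprimeTo ℤ.∣ z ∣))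
fromℤ≡mkℚ z = ℚₚ.↥p/↧p≡p (mkℚ z 0 (Coprimality.sym (1-coprimeTo ℤ.∣ z ∣)))

fromℤ-+ : ∀ a b → fromℤ (a + b) ≡ fromℤ a ℚ.+ fromℤ b
fromℤ-+ a b rewrite fromℤ≡mkℚ a | fromℤ≡mkℚ b =
  cong₂ (λ x y → (x + y) ℚ./ 1) (sym (ℤₚ.*-identityʳ a)) (sym (ℤₚ.*-identityʳ b))

fromℤ-* : ∀ a b → fromℤ (a * b) ≡ fromℤ a ℚ.* fromℤ b
fromℤ-* a b rewrite fromℤ≡mkℚ a | fromℤ≡mkℚ b = refl

fromℤ-neg : ∀ a → fromℤ (- a) ≡ ℚ.- fromℤ a
fromℤ-neg a rewrite fromℤ≡mkℚ (- a) | fromℤ≡mkℚ a with a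
... | + zero     = refl
... | + suc n    = refl
... | ℤ.-[1+ n ] = refl

fromℤ-- : ∀ a b → fromℤ (a - b) ≡ fromℤ a ℚ.- fromℤ b
fromℤ-- a b = trans (fromℤ-+ a (- b)) (cong (fromℤ a ℚ.+_) (fromℤ-neg b))

fromℤ-*-invℕ : ∀ n .{{_ : NonZero n}} → fromℤ (+ n) ℚ.* invℕ n ≡ 1ℚ
fromℤ-*-invℕ (suc n)
  rewrite fromℤ≡mkℚ (+ suc n) | ℚₚ.↥p/↧p≡p (mkℚ (+ 1) n (1-coprimeTo (suc n))) =
  ℚₚ.*-inverseʳ (mkℚ (+ suc n) 0 (Coprimality.sym (1-coprimeTo (suc n))))

invℕ-cancelˡ : ∀ n .{{_ : NonZero n}} z u → invℕ n ℚ.* (fromℤ (+ n * z) ℚ.* u) ≡ fromℤ z ℚ.* u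
invℕ-cancelˡ n z u = begin
  invℕ n ℚ.* (fromℤ (+ n * z) ℚ.* u)           ≡⟨ cong (λ x → invℕ n ℚ.* (x ℚ.* u)) (fromℤ-* (+ n) z) ⟩
  invℕ n ℚ.* (fromℤ (+ n) ℚ.* fromℤ z ℚ.* u)   ≡⟨ regroup (invℕ n) (fromℤ (+ n)) (fromℤ z) u ⟩
  (fromℤ (+ n) ℚ.* invℕ n) ℚ.* (fromℤ z ℚ.* u) ≡⟨ cong (ℚ._* (fromℤ z ℚ.* u)) (fromℤ-*-invℕ n) ⟩
  1ℚ ℚ.* (fromℤ z ℚ.* u)                       ≡⟨ ℚₚ.*-identityˡ _ ⟩
  fromℤ z ℚ.* u                                ∎
  where
  open ≡-Reasoning
  regroup : ∀ i n z u → i ℚ.* (n ℚ.* z ℚ.* u) ≡ (n ℚ.* i) ℚ.* (z ℚ.* u)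
  regroup = solve 4 (λ i n z u → i :* (n :* z :* u) := (n :* i) :* (z :* u)) refl
    where open ℚSolver.+-*-Solver

invℕ-scale : ∀ a d .{{_ : NonZero a}} .{{_ : NonZero d}} b → + a * b ≡ + d → invℕ a ≡ fromℤ b ℚ.* invℕ d
invℕ-scale a d b ab≡d = begin
  invℕ a                                  ≡⟨ ℚₚ.*-identityʳ (invℕ a) ⟨
  invℕ a ℚ.* 1ℚ                           ≡⟨ cong (invℕ a ℚ.*_) (fromℤ-*-invℕ d) ⟨
  invℕ a ℚ.* (fromℤ (+ d) ℚ.* invℕ d)     ≡⟨ cong (λ x → invℕ a ℚ.* (fromℤ x ℚ.* invℕ d)) ab≡d ⟨
  invℕ a ℚ.* (fromℤ (+ a * b) ℚ.* invℕ d) ≡⟨ invℕ-cancelˡ a b (invℕ d) ⟩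
  fromℤ b ℚ.* invℕ d                      ∎
  where open ≡-Reasoning

sumℚ-map-fromℤ : ∀ {A : Set} (f : A → ℤ) u xs →
                 sumℚ (map (λ x → fromℤ (f x) ℚ.* u) xs) ≡ fromℤ (sumℤ (map f xs)) ℚ.* u
sumℚ-map-fromℤ f u []       = sym (ℚₚ.*-zeroˡ u)
sumℚ-map-fromℤ f u (x ∷ xs) = begin
  fromℤ (f x) ℚ.* u ℚ.+ sumℚ (map (λ x → fromℤ (f x) ℚ.* u) xs)
    ≡⟨ cong (fromℤ (f x) ℚ.* u ℚ.+_) (sumℚ-map-fromℤ f u xs) ⟩
  fromℤ (f x) ℚ.* u ℚ.+ fromℤ (sumℤ (map f xs)) ℚ.* u
    ≡⟨ ℚₚ.*-distribʳ-+ u (fromℤ (f x)) _ ⟨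
  (fromℤ (f x) ℚ.+ fromℤ (sumℤ (map f xs))) ℚ.* u
    ≡⟨ cong (ℚ._* u) (fromℤ-+ (f x) _) ⟨
  fromℤ (f x + sumℤ (map f xs)) ℚ.* u ∎
  where open ≡-Reasoning

-- 1/4 - 1/(4p) - 1/(4p²) = (p² - p - 1) / (4p²), and p² - p - 1 = q² + q - 1 for p = q + 1.
constant-term : ∀ N q .{{_ : NonZero N}} .{{_ : NonZero q}} →
  fromℤ (+ q * (+ N * + N * ((+ q) ² + + q - 1ℤ))) ℚ.* invℕ (4 ℕ.* (N ℕ.* N) ℕ.* (suc q ℕ.* suc q) ℕ.* q)
    ≡ invℕ 4 ℚ.- invℕ (4 ℕ.* suc q) ℚ.- invℕ (4 ℕ.* (suc q ℕ.* suc q))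
constant-term N@(suc _) q@(suc _) = begin
  fromℤ (+ q * (+ N * + N * ((+ q) ² + + q - 1ℤ))) ℚ.* u
    ≡⟨ cong (λ z → fromℤ z ℚ.* u) numerator ⟩
  fromℤ (B₁ - B₂ - B₃) ℚ.* u
    ≡⟨ cong (ℚ._* u) (trans (fromℤ-- (B₁ - B₂) B₃) (cong (ℚ._- fromℤ B₃) (fromℤ-- B₁ B₂))) ⟩
  (fromℤ B₁ ℚ.- fromℤ B₂ ℚ.- fromℤ B₃) ℚ.* u
    ≡⟨ distrib (fromℤ B₁) (fromℤ B₂) (fromℤ B₃) ⟩
  fromℤ B₁ ℚ.* u ℚ.- fromℤ B₂ ℚ.* u ℚ.- fromℤ B₃ ℚ.* u
    ≡⟨ cong₂ ℚ._-_ (cong₂ ℚ._-_ (invℕ-scale 4 D B₁ e₁) (invℕ-scale (4 ℕ.* p) D B₂ e₂))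
                   (invℕ-scale (4 ℕ.* (p ℕ.* p)) D B₃ e₃) ⟨
  invℕ 4 ℚ.- invℕ (4 ℕ.* p) ℚ.- invℕ (4 ℕ.* (p ℕ.* p)) ∎
  where
  open ≡-Reasoning
  p D : ℕ
  p = suc q
  D = 4 ℕ.* (N ℕ.* N) ℕ.* (p ℕ.* p) ℕ.* q
  u : ℚ
  u = invℕ D
  B₁ B₂ B₃ : ℤ
  B₁ = + N * + N * (+ p * + p) * + q
  B₂ = + N * + N * + p * + q
  B₃ = + N * + N * + q
  numerator : + q * (+ N * + N * ((+ q) ² + + q - 1ℤ)) ≡ B₁ - B₂ - B₃
  numerator = solve 2 (λ n q → q :* (n :* n :* (q :* q :+ q :- con 1ℤ))
    := n :* n :* ((con 1ℤ :+ q) :* (con 1ℤ :+ q)) :* q :- n :* n :* (con 1ℤ :+ q) :* q :- n :* n :* q)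
    refl (+ N) (+ q)
    where open +-*-Solver
  distrib : ∀ a b c → (a ℚ.- b ℚ.- c) ℚ.* u ≡ a ℚ.* u ℚ.- b ℚ.* u ℚ.- c ℚ.* u
  distrib a b c = solve 4 (λ a b c u → (a :- b :- c) :* u := a :* u :- b :* u :- c :* u) refl a b c u
    where open ℚSolver.+-*-Solver
  -- N, p and q are successors, so + (m ℕ.* n) and + m * + n agree definitionally here.
  e₁ : + 4 * B₁ ≡ + D
  e₁ = solve 3 (λ n p q → con (+ 4) :* (n :* n :* (p :* p) :* q) := con (+ 4) :* (n :* n) :* (p :* p) :* q)
         refl (+ N) (+ p) (+ q)
    where open +-*-Solver
  e₂ : + (4 ℕ.* p) * B₂ ≡ + D
  e₂ = solve 3 (λ n p q → con (+ 4) :* p :* (n :* n :* p :* q) := con (+ 4) :* (n :* n) :* (p :* p) :* q)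
         refl (+ N) (+ p) (+ q)
    where open +-*-Solver
  e₃ : + (4 ℕ.* (p ℕ.* p)) * B₃ ≡ + D
  e₃ = solve 3 (λ n p q → con (+ 4) :* (p :* p) :* (n :* n :* q) := con (+ 4) :* (n :* n) :* (p :* p) :* q)
         refl (+ N) (+ p) (+ q)
    where open +-*-Solver

-- Averaging over sign patterns

module _ (N : ℕ) where

  ±N : Bool → ℤ
  ±N b = if b then + N else - + N

  -- Expanding the square, every cross term ±N ±N c_i c_j with i ≠ j cancels over the sign patterns.
  signs-average : ∀ n (c : Fin n → ℤ) d →
    sumℤ (map (λ s → (∑[ i < n ] (±N (lookup s i) * c i) - d) ²) (allSigns n))
      ≡ + (2 ^ n) * (+ N * + N * ∑[ i < n ] (c i ²) + d ²)
  signs-average zero    c d =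
    solve 2 (λ n d → (con 0ℤ :- d) :* (con 0ℤ :- d) :+ con 0ℤ := con 1ℤ :* (n :* n :* con 0ℤ :+ d :* d))
      refl (+ N) d
    where open +-*-Solver
  signs-average (suc n) c d = begin
    sumℤ (map F (map (true ∷_) S ++ map (false ∷_) S))
      ≡⟨ sumℤ-map-++ F (map (true ∷_) S) (map (false ∷_) S) ⟩
    sumℤ (map F (map (true ∷_) S)) + sumℤ (map F (map (false ∷_) S))
      ≡⟨ cong₂ _+_ (half true) (half false) ⟩
    + (2 ^ n) * (+ N * + N * R + (d - + N * c₀) ²) + + (2 ^ n) * (+ N * + N * R + (d - - + N * c₀) ²)
      ≡⟨ solve 5 (λ P x c₀ R d →
              P :* (x :* x :* R :+ (d :- x :* c₀) :* (d :- x :* c₀))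
           :+ P :* (x :* x :* R :+ (d :- (:- x) :* c₀) :* (d :- (:- x) :* c₀))
           := (con (+ 2) :* P) :* (x :* x :* (c₀ :* c₀ :+ R) :+ d :* d))
         refl (+ (2 ^ n)) (+ N) c₀ R d ⟩
    + 2 * + (2 ^ n) * (+ N * + N * (c₀ ² + R) + d ²)
      ≡⟨ cong (_* (+ N * + N * (c₀ ² + R) + d ²)) (ℤₚ.pos-* 2 (2 ^ n)) ⟨
    + (2 ^ suc n) * (+ N * + N * (c₀ ² + R) + d ²) ∎
    where
    open ≡-Reasoning
    open +-*-Solver
    S = allSigns n
    c₀ = c Fin.zero
    R = ∑[ i < n ] (c (Fin.suc i) ²)
    F : Vec Bool (suc n) → ℤ
    F s = (∑[ i < suc n ] (±N (lookup s i) * c i) - d) ²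
    L : Vec Bool n → ℤ
    L s = ∑[ i < n ] (±N (lookup s i) * c (Fin.suc i))
    regroup : ∀ x l → x * c₀ + l - d ≡ l - (d - x * c₀)
    regroup x l = solve 4 (λ x c₀ l d → x :* c₀ :+ l :- d := l :- (d :- x :* c₀)) refl x c₀ l d
    half : ∀ b → sumℤ (map F (map (b ∷_) S)) ≡ + (2 ^ n) * (+ N * + N * R + (d - ±N b * c₀) ²)
    half b = begin
      sumℤ (map F (map (b ∷_) S))
        ≡⟨ cong sumℤ (Listₚ.map-∘ S) ⟨
      sumℤ (map (F ∘ (b ∷_)) S)
        ≡⟨ cong sumℤ (Listₚ.map-cong (λ s → cong _² (regroup (±N b) (L s))) S) ⟩
      sumℤ (map (λ s → (L s - (d - ±N b * c₀)) ²) S)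
        ≡⟨ signs-average n (c ∘ Fin.suc) (d - ±N b * c₀) ⟩
      + (2 ^ n) * (+ N * + N * R + (d - ±N b * c₀) ²) ∎

-- Units modulo a prime

module _ {q : ℕ} (p-prime : Prime (suc q)) where

  private
    p : ℕ
    p = suc q

    1<p : 1 < p
    1<p = ℕ.nonTrivial⇒n>1 p {{prime⇒nonTrivial p-prime}}

    instance
      q≢0 : NonZero q
      q≢0 = ℕ.>-nonZero (ℕ.s<s⁻¹ 1<p)

  prime∤⇒coprime : ∀ {e} → ¬ p ∣ e → Coprime p e
  prime∤⇒coprime p∤e (d∣p , d∣e) with prime⇒irreducible p-prime d∣p
  ... | inj₁ d≡1  = d≡1
  ... | inj₂ refl = contradiction d∣e p∤e

  *-cancel-mod-≤ : ∀ {e x y} → ¬ p ∣ e → x ≤ y → y < p → (e ℕ.* x) % p ≡ (e ℕ.* y) % p → x ≡ y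
  *-cancel-mod-≤ {e} {x} {y} p∤e x≤y y<p eq
    with euclidsLemma e (y ∸ x) p-prime
           (subst (p ∣_) (sym (ℕₚ.*-distribˡ-∸ e y x)) (%-≡⇒∣∸ (e ℕ.* x) (e ℕ.* y) eq))
  ... | inj₁ p∣e   = contradiction p∣e p∤e
  ... | inj₂ p∣y∸x =
    ℕₚ.≤-antisym x≤y (ℕₚ.m∸n≡0⇒m≤n (∣∧<⇒≡0 (ℕₚ.≤-<-trans (ℕₚ.m∸n≤m y x) y<p) p∣y∸x))

  *-cancel-mod : ∀ {e x y} → ¬ p ∣ e → x < p → y < p → (e ℕ.* x) % p ≡ (e ℕ.* y) % p → x ≡ y
  *-cancel-mod {x = x} {y} p∤e x<p y<p eq with ℕₚ.≤-total x y
  ... | inj₁ x≤y = *-cancel-mod-≤ p∤e x≤y y<p eq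
  ... | inj₂ y≤x = sym (*-cancel-mod-≤ p∤e y≤x x<p (sym eq))

  inverse-mod : ∀ {e} → ¬ p ∣ e → ∃ λ w → (e ℕ.* w) % p ≡ 1
  inverse-mod {e} p∤e with coprime-Bézout (prime∤⇒coprime p∤e)
  ... | Bézout.-+ x y 1+xp≡ye = y , (begin
    (e ℕ.* y) % p       ≡⟨ cong (_% p) (ℕₚ.*-comm e y) ⟩
    (y ℕ.* e) % p       ≡⟨ cong (_% p) 1+xp≡ye ⟨
    (1 ℕ.+ x ℕ.* p) % p ≡⟨ [m+kn]%n≡m%n 1 x p ⟩
    1 % p               ≡⟨ m<n⇒m%n≡m 1<p ⟩
    1                   ∎)
    where open ≡-Reasoning
  -- Here y e ≡ -1, so y (p - 1) inverts e.
  ... | Bézout.+- x y 1+ye≡xp = y ℕ.* q , (begin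
    (e ℕ.* (y ℕ.* q)) % p             ≡⟨ [m+kn]%n≡m%n (e ℕ.* (y ℕ.* q)) 1 p ⟨
    (e ℕ.* (y ℕ.* q) ℕ.+ 1 ℕ.* p) % p ≡⟨ cong (_% p) (expand e y) ⟩
    ((1 ℕ.+ y ℕ.* e) ℕ.* q ℕ.+ 1) % p ≡⟨ cong (λ z → (z ℕ.* q ℕ.+ 1) % p) 1+ye≡xp ⟩
    (x ℕ.* p ℕ.* q ℕ.+ 1) % p         ≡⟨ cong (_% p) (swap x) ⟩
    (1 ℕ.+ x ℕ.* q ℕ.* p) % p         ≡⟨ [m+kn]%n≡m%n 1 (x ℕ.* q) p ⟩
    1 % p                             ≡⟨ m<n⇒m%n≡m 1<p ⟩
    1                                 ∎)
    where
    open ≡-Reasoning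
    open ℕSolver.+-*-Solver
    expand : ∀ e y → e ℕ.* (y ℕ.* q) ℕ.+ 1 ℕ.* p ≡ (1 ℕ.+ y ℕ.* e) ℕ.* q ℕ.+ 1
    expand e y = solve 3 (λ e y q → e :* (y :* q) :+ con 1 :* (con 1 :+ q) := (con 1 :+ y :* e) :* q :+ con 1)
                   refl e y q
    swap : ∀ x → x ℕ.* p ℕ.* q ℕ.+ 1 ≡ 1 ℕ.+ x ℕ.* q ℕ.* p
    swap x = solve 2 (λ x q → x :* (con 1 :+ q) :* q :+ con 1 := con 1 :+ x :* q :* (con 1 :+ q)) refl x q

  mul-mod-hits-1 : ∀ {e} → ¬ p ∣ e → ∃ λ (k : Fin q) → (e ℕ.* suc (toℕ k)) % p ≡ 1
  mul-mod-hits-1 {e} p∤e with w , ew≡1 ← inverse-mod p∤e =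
    from-residue (w % p) (m%n<n w p) (trans ([m*[n%o]]%o≡[m*n]%o e w p) ew≡1)
    where
    from-residue : ∀ r → r < p → (e ℕ.* r) % p ≡ 1 → ∃ λ (k : Fin q) → (e ℕ.* suc (toℕ k)) % p ≡ 1
    from-residue zero    _         e0≡1 =
      contradiction (trans (cong (_% p) (sym (ℕₚ.*-zeroʳ e))) e0≡1) (λ ())
    from-residue (suc k) (s≤s k<q) ek≡1 =
      Fin.fromℕ< k<q , subst (λ j → (e ℕ.* suc j) % p ≡ 1) (sym (Finₚ.toℕ-fromℕ< k<q)) ek≡1

  mul-mod-injective : ∀ {e} → ¬ p ∣ e → ∀ {k k′ : Fin q} →
                      (e ℕ.* suc (toℕ k)) % p ≡ (e ℕ.* suc (toℕ k′)) % p → k ≡ k′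
  mul-mod-injective p∤e {k} {k′} eq = Finₚ.toℕ-injective (ℕₚ.suc-injective
    (*-cancel-mod p∤e (s≤s (Finₚ.toℕ<n k)) (s≤s (Finₚ.toℕ<n k′)) eq))

  mul-mod-nonzero : ∀ {e} → ¬ p ∣ e → ∀ (k : Fin q) → (e ℕ.* suc (toℕ k)) % p ≢ 0
  mul-mod-nonzero {e} p∤e k eq = contradiction
    (*-cancel-mod p∤e (s≤s (Finₚ.toℕ<n k)) (s≤s ℕ.z≤n) (trans eq (cong (_% p) (sym (ℕₚ.*-zeroʳ e)))))
    (λ ())

  -- Traces in ℤ[ω]

  -- Tr(ω^e): ω^e is 1 when p ∣ e; otherwise its p - 1 conjugates are all the roots ≠ 1, summing to -1.
  trPow : ℕ → ℤ
  trPow e = if e % p ≡ᵇ 0 then + q else -1ℤ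

  trPow-∣ : ∀ {e} → p ∣ e → trPow e ≡ + q
  trPow-∣ {e} p∣e = if-≡ᵇ-yes (n∣m⇒m%n≡0 e p p∣e)

  trPow-∤ : ∀ {e} → ¬ p ∣ e → trPow e ≡ -1ℤ
  trPow-∤ {e} p∤e = if-≡ᵇ-no (p∤e ∘ m%n≡0⇒n∣m e p)

  conjugateCoef : ℤ → ℕ → ℕ → ℤ
  conjugateCoef c e r = ∑[ k < q ] (if (e ℕ.* suc (toℕ k)) % p ≡ᵇ r then c else 0ℤ)

  -- For p ∤ e the residues e (k + 1) are distinct and nonzero, so exactly one conjugate of ω^e is ω.
  monomial-trace : ∀ c e → conjugateCoef c e 0 - conjugateCoef c e 1 ≡ c * trPow e
  monomial-trace c e with p ∣? e
  ... | yes p∣e = begin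
    conjugateCoef c e 0 - conjugateCoef c e 1
      ≡⟨ cong₂ _-_ (sum-cong-≗ (λ k → if-≡ᵇ-yes (≡0 k)))
                   (sum-cong-≗ (λ k → if-≡ᵇ-no (λ ≡1 → 0≢1 (trans (sym (≡0 k)) ≡1)))) ⟩
    (∑[ k < q ] c) - (∑[ k < q ] 0ℤ)
      ≡⟨ cong₂ _-_ (∑-const q c) (sum-replicate-zero q) ⟩
    + q * c - 0ℤ
      ≡⟨ solve 2 (λ q c → q :* c :- con 0ℤ := c :* q) refl (+ q) c ⟩
    c * + q
      ≡⟨ cong (c *_) (trPow-∣ p∣e) ⟨
    c * trPow e ∎
    where
    open ≡-Reasoning
    open +-*-Solver
    0≢1 : 0 ≢ 1
    0≢1 ()
    ≡0 : ∀ (k : Fin q) → (e ℕ.* suc (toℕ k)) % p ≡ 0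
    ≡0 k = n∣m⇒m%n≡0 _ p (∣m⇒∣m*n (suc (toℕ k)) p∣e)
  ... | no p∤e with k₀ , hit ← mul-mod-hits-1 p∤e = begin
    conjugateCoef c e 0 - conjugateCoef c e 1
      ≡⟨ cong₂ _-_ (sum-cong-≗ (λ k → if-≡ᵇ-no (mul-mod-nonzero p∤e k)))
                   (∑-const-except _ k₀ 0ℤ (λ k k≢k₀ →
                      if-≡ᵇ-no (λ ≡1 → k≢k₀ (mul-mod-injective p∤e (trans ≡1 (sym hit)))))) ⟩
    (∑[ k < q ] 0ℤ) - ((if (e ℕ.* suc (toℕ k₀)) % p ≡ᵇ 1 then c else 0ℤ) - 0ℤ + + q * 0ℤ)
      ≡⟨ cong₂ (λ z t → z - (t - 0ℤ + + q * 0ℤ)) (sum-replicate-zero q) (if-≡ᵇ-yes hit) ⟩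
    0ℤ - (c - 0ℤ + + q * 0ℤ)
      ≡⟨ solve 2 (λ c q → con 0ℤ :- (c :- con 0ℤ :+ q :* con 0ℤ) := c :* con -1ℤ) refl c (+ q) ⟩
    c * -1ℤ
      ≡⟨ cong (c *_) (trPow-∤ p∤e) ⟨
    c * trPow e ∎
    where
    open ≡-Reasoning
    open +-*-Solver

  coef-concatMap : ∀ r {A : Set} (F : A → Expr) xs → coef p r (concatMap F xs) ≡ sumℤ (map (coef p r ∘ F) xs)
  coef-concatMap r F []       = refl
  coef-concatMap r F (x ∷ xs) =
    trans (sumℤ-map-++ _ (F x) (concatMap F xs)) (cong (_+_ (coef p r (F x))) (coef-concatMap r F xs))

  conjugateSum : ℕ → Expr → ℤ
  conjugateSum r γ = ∑[ k < q ] coef p r (σ (suc (toℕ k)) γ)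

  coef-TrExpr : ∀ r γ → coef p r (TrExpr p γ) ≡ conjugateSum r γ
  coef-TrExpr r γ = begin
    coef p r (concatMap (λ k → σ (suc k) γ) (applyUpTo id q))  ≡⟨ coef-concatMap r _ (applyUpTo id q) ⟩
    sumℤ (map (λ k → coef p r (σ (suc k) γ)) (applyUpTo id q)) ≡⟨ cong sumℤ (Listₚ.map-applyUpTo id _ q) ⟩
    sumℤ (applyUpTo (λ k → coef p r (σ (suc k) γ)) q)          ≡⟨ sumℤ-applyUpTo q _ ⟩
    conjugateSum r γ                                           ∎
    where open ≡-Reasoning

  trTerm : ℤ × ℕ → ℤ
  trTerm (c , e) = c * trPow e

  ratValue-TrExpr : ∀ γ → ratValue p (TrExpr p γ) ≡ sumℤ (map trTerm γ)
  ratValue-TrExpr γ = trans (cong₂ _-_ (coef-TrExpr 0 γ) (coef-TrExpr 1 γ)) (termwise γ)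
    where
    termwise : ∀ γ → conjugateSum 0 γ - conjugateSum 1 γ ≡ sumℤ (map trTerm γ)
    termwise []            = cong₂ _-_ (sum-replicate-zero q) (sum-replicate-zero q)
    termwise ((c , e) ∷ γ) = begin
      conjugateSum 0 ((c , e) ∷ γ) - conjugateSum 1 ((c , e) ∷ γ)
        ≡⟨ cong₂ _-_ (∑-distrib-+ (term 0) (λ k → coef p 0 (σ (suc (toℕ k)) γ)))
                     (∑-distrib-+ (term 1) (λ k → coef p 1 (σ (suc (toℕ k)) γ))) ⟩
      (conjugateCoef c e 0 + conjugateSum 0 γ) - (conjugateCoef c e 1 + conjugateSum 1 γ)
        ≡⟨ interchange (conjugateCoef c e 0) (conjugateSum 0 γ) (conjugateCoef c e 1) (conjugateSum 1 γ) ⟩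
      (conjugateCoef c e 0 - conjugateCoef c e 1) + (conjugateSum 0 γ - conjugateSum 1 γ)
        ≡⟨ cong₂ _+_ (monomial-trace c e) (termwise γ) ⟩
      c * trPow e + sumℤ (map trTerm γ) ∎
      where
      open ≡-Reasoning
      term : ℕ → Fin q → ℤ
      term r k = if (e ℕ.* suc (toℕ k)) % p ≡ᵇ r then c else 0ℤ
      interchange : ∀ a b c d → (a + b) - (c + d) ≡ (a - c) + (b - d)
      interchange = solve 4 (λ a b c d → (a :+ b) :- (c :+ d) := (a :- c) :+ (b :- d)) refl
        where open +-*-Solver

  Trω-∑ : ∀ (γ : Zω p) j → Trω p γ j ≡ ∑[ i < q ] (γ i * trPow (suc (toℕ i) ℕ.+ j))
  Trω-∑ γ j = begin
    ratValue p (TrExpr p (mulPow j (toExpr p γ)))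
      ≡⟨ ratValue-TrExpr (mulPow j (toExpr p γ)) ⟩
    sumℤ (map trTerm (mulPow j (map (λ i → γ i , suc (toℕ i)) (allFin q))))
      ≡⟨ cong (sumℤ ∘ map trTerm ∘ mulPow j) (Listₚ.map-tabulate {n = q} id _) ⟩
    sumℤ (map trTerm (mulPow j (tabulate (λ i → γ i , suc (toℕ i)))))
      ≡⟨ cong (sumℤ ∘ map trTerm) (Listₚ.map-tabulate {n = q} _ _) ⟩
    sumℤ (map trTerm (tabulate (λ i → γ i , suc (toℕ i) ℕ.+ j)))
      ≡⟨ cong sumℤ (Listₚ.map-tabulate {n = q} _ trTerm) ⟩
    sumℤ (tabulate (λ i → γ i * trPow (suc (toℕ i) ℕ.+ j)))
      ≡⟨ sumℤ-tabulate {q} _ ⟩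
    ∑[ i < q ] (γ i * trPow (suc (toℕ i) ℕ.+ j)) ∎
    where open ≡-Reasoning

  Trω-sub : ∀ β α j → Trω p (subω p β α) j ≡ Trω p β j - Trω p α j
  Trω-sub β α j = begin
    Trω p (subω p β α) j                            ≡⟨ Trω-∑ (subω p β α) j ⟩
    ∑[ i < q ] ((β i - α i) * t i)                  ≡⟨ sum-cong-≗ distrib ⟩
    ∑[ i < q ] (β i * t i - α i * t i)              ≡⟨ ∑-distrib-- (λ i → β i * t i) (λ i → α i * t i) ⟩
    ∑[ i < q ] (β i * t i) - ∑[ i < q ] (α i * t i) ≡⟨ cong₂ _-_ (Trω-∑ β j) (Trω-∑ α j) ⟨
    Trω p β j - Trω p α j                           ∎
    where
    open ≡-Reasoning
    t : Fin q → ℤ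
    t i = trPow (suc (toℕ i) ℕ.+ j)
    distrib : ∀ i → (β i - α i) * t i ≡ β i * t i - α i * t i
    distrib i = trans (ℤₚ.*-distribʳ-+ (t i) (β i) (- α i))
                      (cong (_+_ (β i * t i)) (sym (ℤₚ.neg-distribˡ-* (α i) (t i))))

  Trω-0 : ∀ j → Trω p (0ω p) j ≡ 0ℤ
  Trω-0 j = trans (Trω-∑ (0ω p) j) (sum-replicate-zero q)

  normSq-sub : ∀ β α →
               normSq p (subω p β α) ≡ ∑[ k < q ] ((Trω p β (suc (toℕ k)) - Trω p α (suc (toℕ k))) ²)
  normSq-sub β α = trans (sumℤ-applyUpTo q _) (sum-cong-≗ {q} (λ k → cong _² (Trω-sub β α (suc (toℕ k)))))

  normSq-sub-0 : ∀ α → normSq p (subω p α (0ω p)) ≡ ∑[ k < q ] (Trω p α (suc (toℕ k)) ²)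
  normSq-sub-0 α = trans (normSq-sub α (0ω p)) (sum-cong-≗ {q} (λ k → cong _² (begin
    Trω p α (suc (toℕ k)) - Trω p (0ω p) (suc (toℕ k)) ≡⟨ cong (_-_ (Trω p α (suc (toℕ k)))) (Trω-0 _) ⟩
    Trω p α (suc (toℕ k)) - 0ℤ                         ≡⟨ ℤₚ.+-identityʳ _ ⟩
    Trω p α (suc (toℕ k))                              ∎)))
    where open ≡-Reasoning

  -- Tr(ω^(i+1) ω^(k+1)) is q on the anti-diagonal i = opposite k and -1 elsewhere.
  row-sum : ∀ (k : Fin q) → ∑[ i < q ] (trPow (suc (toℕ i) ℕ.+ suc (toℕ k)) ²) ≡ (+ q) ² + + q - 1ℤ
  row-sum k = begin
    ∑[ i < q ] (trPow (suc (toℕ i) ℕ.+ suc (toℕ k)) ²)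
      ≡⟨ ∑-const-except _ (Fin.opposite k) 1ℤ (λ i i≢ → cong _² (trPow-∤ (i≢ ∘ p∣⇒opposite i))) ⟩
    trPow (suc (toℕ (Fin.opposite k)) ℕ.+ suc (toℕ k)) ² - 1ℤ + + q * 1ℤ
      ≡⟨ cong (λ t → t ² - 1ℤ + + q * 1ℤ) (trPow-∣ (subst (p ∣_) (sym diagonal) ∣-refl)) ⟩
    (+ q) ² - 1ℤ + + q * 1ℤ
      ≡⟨ solve 1 (λ q → q :* q :- con 1ℤ :+ q :* con 1ℤ := q :* q :+ q :- con 1ℤ) refl (+ q) ⟩
    (+ q) ² + + q - 1ℤ ∎
    where
    open ≡-Reasoning
    open +-*-Solver
    diagonal : suc (toℕ (Fin.opposite k)) ℕ.+ suc (toℕ k) ≡ p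
    diagonal = cong suc (trans (cong (ℕ._+ suc (toℕ k)) (Finₚ.opposite-prop k)) (ℕₚ.m∸n+n≡m (Finₚ.toℕ<n k)))
    p∣⇒opposite : ∀ i → p ∣ suc (toℕ i) ℕ.+ suc (toℕ k) → i ≡ Fin.opposite k
    p∣⇒opposite i p∣ = Finₚ.toℕ-injective (ℕₚ.suc-injective (ℕₚ.+-cancelʳ-≡ (suc (toℕ k)) _ _ (begin
      suc (toℕ i) ℕ.+ suc (toℕ k)
        ≡⟨ ∣∧<2*⇒≡ (s≤s ℕ.z≤n) (ℕₚ.+-mono-< (s≤s (Finₚ.toℕ<n i)) (s≤s (Finₚ.toℕ<n k))) p∣ ⟩
      p
        ≡⟨ diagonal ⟨
      suc (toℕ (Fin.opposite k)) ℕ.+ suc (toℕ k) ∎)))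

  module _ (N : ℕ) where

    signs-average-Trω : ∀ (k : Fin q) a →
      sumℤ (map (λ s → (Trω p (signed p N s) (suc (toℕ k)) - a) ²) (allSigns q))
        ≡ + (2 ^ q) * (+ N * + N * ((+ q) ² + + q - 1ℤ) + a ²)
    signs-average-Trω k a = begin
      sumℤ (map (λ s → (Trω p (signed p N s) (suc (toℕ k)) - a) ²) (allSigns q))
        ≡⟨ cong sumℤ (Listₚ.map-cong (λ s → cong (λ t → (t - a) ²) (Trω-∑ (signed p N s) _)) (allSigns q)) ⟩
      sumℤ (map (λ s → (∑[ i < q ] (±N N (lookup s i) * t i) - a) ²) (allSigns q))
        ≡⟨ signs-average N q t a ⟩
      + (2 ^ q) * (+ N * + N * ∑[ i < q ] (t i ²) + a ²)
        ≡⟨ cong (λ r → + (2 ^ q) * (+ N * + N * r + a ²)) (row-sum k) ⟩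
      + (2 ^ q) * (+ N * + N * ((+ q) ² + + q - 1ℤ) + a ²) ∎
      where
      open ≡-Reasoning
      t : Fin q → ℤ
      t i = trPow (suc (toℕ i) ℕ.+ suc (toℕ k))

    sum-normSq-𝒱 : ∀ α → sumℤ (map (λ x → normSq p (subω p x α)) (𝒱 p N))
                         ≡ + (2 ^ q) * (+ q * (+ N * + N * ((+ q) ² + + q - 1ℤ)) + normSq p (subω p α (0ω p)))
    sum-normSq-𝒱 α = begin
      sumℤ (map (λ x → normSq p (subω p x α)) (map (signed p N) (allSigns q)))
        ≡⟨ cong sumℤ (Listₚ.map-∘ (allSigns q)) ⟨
      sumℤ (map (λ s → normSq p (subω p (signed p N s) α)) (allSigns q))
        ≡⟨ cong sumℤ (Listₚ.map-cong (λ s → normSq-sub (signed p N s) α) (allSigns q)) ⟩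
      sumℤ (map (λ s → ∑[ k < q ] ((Trω p (signed p N s) (suc (toℕ k)) - a k) ²)) (allSigns q))
        ≡⟨ sumℤ-map-∑ {n = q} _ (allSigns q) ⟩
      ∑[ k < q ] sumℤ (map (λ s → (Trω p (signed p N s) (suc (toℕ k)) - a k) ²) (allSigns q))
        ≡⟨ sum-cong-≗ (λ k → signs-average-Trω k (a k)) ⟩
      ∑[ k < q ] (+ (2 ^ q) * (C + a k ²))
        ≡⟨ *-distribˡ-sum (+ (2 ^ q)) (λ k → C + a k ²) ⟨
      + (2 ^ q) * ∑[ k < q ] (C + a k ²)
        ≡⟨ cong (_*_ (+ (2 ^ q))) (∑-distrib-+ (λ _ → C) (λ k → a k ²)) ⟩
      + (2 ^ q) * (∑[ k < q ] C + ∑[ k < q ] (a k ²))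
        ≡⟨ cong₂ (λ u v → + (2 ^ q) * (u + v)) (∑-const q C) (sym (normSq-sub-0 α)) ⟩
      + (2 ^ q) * (+ q * C + normSq p (subω p α (0ω p))) ∎
      where
      open ≡-Reasoning
      a : Fin q → ℤ
      a k = Trω p α (suc (toℕ k))
      C : ℤ
      C = + N * + N * ((+ q) ² + + q - 1ℤ)

  average : ∀ N .{{_ : NonZero N}} α →
            A p N α ≡ dSq p N (0ω p) α ℚ.+ invℕ 4 ℚ.- invℕ (4 ℕ.* p) ℚ.- invℕ (4 ℕ.* (p ℕ.* p))
  average N α = begin
    invℕ (2 ^ q) ℚ.* sumℚ (map (dSq p N α) (𝒱 p N))
      ≡⟨ cong (invℕ (2 ^ q) ℚ.*_) (sumℚ-map-fromℤ (λ x → normSq p (subω p x α)) u (𝒱 p N)) ⟩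
    invℕ (2 ^ q) ℚ.* (fromℤ (sumℤ (map (λ x → normSq p (subω p x α)) (𝒱 p N))) ℚ.* u)
      ≡⟨ cong (λ z → invℕ (2 ^ q) ℚ.* (fromℤ z ℚ.* u)) (sum-normSq-𝒱 N α) ⟩
    invℕ (2 ^ q) ℚ.* (fromℤ (+ (2 ^ q) * (K + X)) ℚ.* u)
      ≡⟨ invℕ-cancelˡ (2 ^ q) {{ℕₚ.m^n≢0 2 q}} (K + X) u ⟩
    fromℤ (K + X) ℚ.* u
      ≡⟨ trans (cong (ℚ._* u) (fromℤ-+ K X)) (ℚₚ.*-distribʳ-+ u (fromℤ K) (fromℤ X)) ⟩
    fromℤ K ℚ.* u ℚ.+ fromℤ X ℚ.* u
      ≡⟨ cong (ℚ._+ fromℤ X ℚ.* u) (constant-term N q) ⟩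
    invℕ 4 ℚ.- invℕ (4 ℕ.* p) ℚ.- invℕ (4 ℕ.* (p ℕ.* p)) ℚ.+ fromℤ X ℚ.* u
      ≡⟨ rotate (invℕ 4) (invℕ (4 ℕ.* p)) (invℕ (4 ℕ.* (p ℕ.* p))) (fromℤ X ℚ.* u) ⟩
    fromℤ X ℚ.* u ℚ.+ invℕ 4 ℚ.- invℕ (4 ℕ.* p) ℚ.- invℕ (4 ℕ.* (p ℕ.* p)) ∎
    where
    open ≡-Reasoning
    u : ℚ
    u = invℕ (4 ℕ.* (N ℕ.* N) ℕ.* (p ℕ.* p) ℕ.* q)
    K X : ℤ
    K = + q * (+ N * + N * ((+ q) ² + + q - 1ℤ))
    X = normSq p (subω p α (0ω p))
    rotate : ∀ a b c d → a ℚ.- b ℚ.- c ℚ.+ d ≡ d ℚ.+ a ℚ.- b ℚ.- c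
    rotate = solve 4 (λ a b c d → a :- b :- c :+ d := d :+ a :- b :- c) refl
      where open ℚSolver.+-*-Solver

lemma3 : (p N : ℕ) → Prime p → ¬ (2 ∣ p) → 1 ≤ N → (α : Zω p) →
         A p N α ≡ dSq p N (0ω p) α ℚ.+ invℕ 4 ℚ.- invℕ (4 ℕ.* p) ℚ.- invℕ (4 ℕ.* (p ℕ.* p))
lemma3 (suc q) (suc n) p-prime _ _ α = average p-prime (suc n) α
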